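{- Let $S$ be a decision rule system. Then $h_{ESR}(S)=h_{ESR}(R_{SR}(S))$ and $h_{EAD}(S)=h_{EAD}(R_{AD}(S))$.
   Context: Let $\omega=\{0,1,2,\dots\}$ and let $\{a_i:i\in\omega\}$ be a set of attributes. A decision rule $r$ is an expression $(a_{i_1}=\delta_1)\wedge\cdots\wedge(a_{i_m}=\delta_m)\to\sigma$ with $m\in\omega$, pairwise different attributes, and $\delta_j,\sigma\in\omega$. Its right-hand side is $\sigma$, $A(r)=\{a_{i_1},\dots,a_{i_m}\}$, and $K(r)=\{a_{i_1}=\delta_1,\dots,a_{i_m}=\delta_m\}$. Two rules are equal iff they have the same $K(\cdot)$ and the same right-hand side. A decision rule system $S$ is a finite nonempty set of decision rules. Let $A(S)=\bigcup_{r\in S}A(r)$, $n(S)=|A(S)|$, and let $D(Z)$ be the set of right-hand sides of rules in $Z\subseteq S$. For $a_i\in A(S)$, $V_S(a_i)=\{\delta:(a_i=\delta)\in\bigcup_{r\in S}K(r)\}$ and $EV_S(a_i)=V_S(a_i)\cup\{*\}$, where $*$ is a symbol not in $\omega$. A set of equations $\{a_{i_1}=\delta_1,\dots,a_{i_m}=\delta_m\}$ with $\delta_j\in\omega\cup\{*\}$ is inconsistent if there are $l\ne t$ with $i_l=i_t$ and $\delta_l\ne\delta_t$, and consistent otherwise. $R_{SR}(S)$ is the set of $r\in S$ for which there is no $r'\in S$ with $K(r')\subsetneq K(r)$. $R_{AD}(S)$ is the set of $r\in S$ for which there is no $r'\in S$ with the same right-hand side as $r$ and $K(r')\subsetneq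 K(r)$. A decision tree over $S$ is a finite directed rooted tree with working nodes labeled by attributes from $A(S)$ and terminal nodes labeled by subsets of $S$. In an e-tree, a working node labeled $a_i$ has exactly $|EV_S(a_i)|$ outgoing edges, labeled with pairwise distinct elements of $EV_S(a_i)$. For a complete path $\xi$ (root to terminal node), $K(\xi)$ is the set of equations $a_i=\delta$ with $a_i$ labeling a working node of $\xi$ and $\delta$ labeling the edge of $\xi$ leaving it. $\tau(\xi)$ is the label of the terminal node of $\xi$, and $h(\xi)$ is the number of working nodes of $\xi$. The depth $h(\Gamma)$ is the maximum of $h(\xi)$ over complete paths. An e-tree over $S$ solves $EAD(S)$ if every complete path $\xi$ with $K(\xi)$ consistent satisfies: $K(r)\subseteq K(\xi)$ for $r\in\tau(\xi)$, and $K(r)\cup K(\xi)$ is inconsistent for each $r\in S\setminus\tau(\xi)$ whose right-hand side is not in $D(\tau(\xi))$. It solves $ESR(S)$ if every such $\xi$ satisfies: $K(r)\subseteq K(\xi)$ for $r\in\tau(\xi)$, and if $\tau(\xi)=\emptyset$ then $K(r)\cup K(\xi)$ is inconsistent for all $r\in S$. $h_{ESR}(S)$ and $h_{EAD}(S)$ are the minimum depths of an e-tree over $S$ solving $ESR(S)$ and $EAD(S)$, respectively. If $n(S)=0$, they are $0$. -}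

module Defs where

open import Data.Nat using (ℕ; _≤_)
open import Data.Maybe using (Maybe; just; nothing)
open import Data.Product using (Σ; ∃; ∃-syntax; _×_; _,_; proj₁; proj₂)
open import Data.Sum using (_⊎_)
open import Data.Unit using (⊤)
open import Data.Empty using (⊥)
open import Data.List using (List; []; _∷_; map; filter; _++_)
open import Data.List.Membership.Propositional using (_∈_; _∉_)
open import Data.List.Relation.Unary.All using (All; all?)
open import Data.List.Relation.Unary.Any using (any?)
open import Data.List.Relation.Unary.Unique.Propositional using (Unique)
open import Relation.Nullary using (¬_; Dec; ¬?; _×-dec_)
open import Relation.Binary.PropositionalEquality using (_≡_; _≢_)
import Data.List.Membership.DecPropositional as DecMem
open import Data.Nat.Properties as ℕP using ()
open import Data.Product.Properties using (≡-dec)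

-- Attributes a_i are represented by their index i : ℕ.
-- An equation a_i = δ (δ ∈ ω) is a pair (i , δ) : ℕ × ℕ.
-- Extended values ω ∪ {*} are Maybe ℕ, with  nothing  playing the role of *.

Eq : Set
Eq = ℕ × ℕ

EEq : Set
EEq = ℕ × Maybe ℕ

record Rule : Set where
  constructor _⇒_
  field
    K   : List Eq
    rhs : ℕ
open Rule public

WFRule : Rule → Set
WFRule r = Unique (map proj₁ (K r))

-- A decision rule system: a finite nonempty set of (well-formed) rules,
-- represented by a list (set semantics; all notions below are invariant
-- under duplication/permutation of the list).
IsSystem : List Rule → Set
IsSystem S = (S ≢ []) × All WFRule S

_⊆E_ : List Eq → List Eq → Set
xs ⊆E ys = All (_∈ ys) xs

_⊂E_ : List Eq → List Eq → Set
xs ⊂E ys = (xs ⊆E ys) × ¬ (ys ⊆E xs)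

_≟Eq_ : (x y : Eq) → Dec (x ≡ y)
_≟Eq_ = ≡-dec ℕP._≟_ ℕP._≟_

_⊆E?_ : (xs ys : List Eq) → Dec (xs ⊆E ys)
xs ⊆E? ys = all? (λ x → DecMem._∈?_ _≟Eq_ x ys) xs

_⊂E?_ : (xs ys : List Eq) → Dec (xs ⊂E ys)
xs ⊂E? ys = (xs ⊆E? ys) ×-dec ¬? (ys ⊆E? xs)

RSR : List Rule → List Rule
RSR S = filter (λ r → ¬? (any? (λ r' → K r' ⊂E? K r) S)) S

RAD : List Rule → List Rule
RAD S = filter (λ r → ¬? (any? (λ r' → (rhs r' ℕP.≟ rhs r) ×-dec (K r' ⊂E? K r)) S)) S

InA : List Rule → ℕ → Set
InA S a = ∃[ r ] (r ∈ S × ∃[ v ] ((a , v) ∈ K r))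

NoAttrs : List Rule → Set
NoAttrs S = All (λ r → K r ≡ []) S

InEV : List Rule → ℕ → Maybe ℕ → Set
InEV S a δ = (δ ≡ nothing) ⊎ (∃[ v ] ((δ ≡ just v) × ∃[ r ] (r ∈ S × (a , v) ∈ K r)))

data Tree : Set where
  leaf : List Rule → Tree
  node : ℕ → List (Maybe ℕ × Tree) → Tree

mutual
  depth : Tree → ℕ
  depth (leaf _)    = 0
  depth (node a es) = Data.Nat.suc (depthEs es)

  depthEs : List (Maybe ℕ × Tree) → ℕ
  depthEs []             = 0
  depthEs ((_ , t) ∷ es) = depth t Data.Nat.⊔ depthEs es

mutual
  IsETree : List Rule → Tree → Set
  IsETree S (leaf τ)    = All (_∈ S) τ
  IsETree S (node a es) =
    InA S a
    × Unique (map proj₁ es)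
    × (∀ δ → (δ ∈ map proj₁ es → InEV S a δ) × (InEV S a δ → δ ∈ map proj₁ es))
    × IsETreeEs S es

  IsETreeEs : List Rule → List (Maybe ℕ × Tree) → Set
  IsETreeEs S []             = ⊤
  IsETreeEs S ((_ , t) ∷ es) = IsETree S t × IsETreeEs S es

-- every complete path ξ (with K(ξ) accumulated in acc) satisfies P K(ξ) τ(ξ)
mutual
  AllPaths : (List EEq → List Rule → Set) → List EEq → Tree → Set
  AllPaths P acc (leaf τ)    = P acc τ
  AllPaths P acc (node a es) = AllPathsEs P acc a es

  AllPathsEs : (List EEq → List Rule → Set) → List EEq → ℕ → List (Maybe ℕ × Tree) → Set
  AllPathsEs P acc a []             = ⊤
  AllPathsEs P acc a ((δ , t) ∷ es) = AllPaths P ((a , δ) ∷ acc) t × AllPathsEs P acc a es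

Inconsistent : List EEq → Set
Inconsistent E = ∃[ a ] ∃[ δ ] ∃[ δ' ] ((a , δ) ∈ E × (a , δ') ∈ E × δ ≢ δ')

Consistent : List EEq → Set
Consistent E = ¬ Inconsistent E

liftK : List Eq → List EEq
liftK = map (λ e → proj₁ e , just (proj₂ e))

RuleRealized : Rule → List EEq → Set
RuleRealized r E = All (_∈ E) (liftK (K r))

D : List Rule → List ℕ
D = map rhs

ESRCond : List Rule → List EEq → List Rule → Set
ESRCond S E τ = Consistent E →
  All (λ r → RuleRealized r E) τ
  × (τ ≡ [] → ∀ r → r ∈ S → Inconsistent (liftK (K r) ++ E))

EADCond : List Rule → List EEq → List Rule → Set
EADCond S E τ = Consistent E →
  All (λ r → RuleRealized r E) τ
  × (∀ r → r ∈ S → r ∉ τ → ¬ (rhs r ∈ D τ) → Inconsistent (liftK (K r) ++ E))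

SolvesESR : List Rule → Tree → Set
SolvesESR S t = AllPaths (ESRCond S) [] t

SolvesEAD : List Rule → Tree → Set
SolvesEAD S t = AllPaths (EADCond S) [] t

IsMinDepth : (List Rule → Tree → Set) → List Rule → ℕ → Set
IsMinDepth Solves S d =
  (Σ Tree λ t → IsETree S t × Solves S t × depth t ≡ d)
  × (∀ t → IsETree S t → Solves S t → d ≤ depth t)

-- "h(S) = d", with the convention h(S) = 0 when n(S) = 0
IsH : (List Rule → Tree → Set) → List Rule → ℕ → Set
IsH Solves S d = (NoAttrs S × d ≡ 0) ⊎ (¬ NoAttrs S × IsMinDepth Solves S d)

IsHESR : List Rule → ℕ → Set
IsHESR = IsH SolvesESR

IsHEAD : List Rule → ℕ → Set
IsHEAD = IsH SolvesEAD

{-# OPTIONS --safe #-}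
-- Relabelling every terminal node by all rules realized along its path never breaks a solving
-- tree, so whether a path is finished depends only on the equations E collected so far; the
-- optimal depth is then the least k such that the empty path is Solvable within k queries.
-- For R = R_SR(S) (resp. R_AD(S)) a path is finished for S exactly when it is finished for R:
-- every rule r of S lies above a rule r′ of R, K(r′) ⊆ K(r) (with the same right-hand side for
-- R_AD), and realizedness passes from r down to r′ while inconsistency with E passes up.
-- A strategy for S turns into one for R by skipping queries of attributes outside A(R)
-- (following the branch already fixed on the path, or *), and a strategy for R serves for S
-- after mapping values outside V_R(a) to *. Neither change affects the equations that matter
-- to R, so S and R have the same solvable depths.
module Submission where

open import Defs
open import Data.Empty using (⊥-elim)
open import Data.List using (List; []; _∷_; _++_; map; filter; length; concatMap; deduplicate)
open import Data.List.Properties as List using ()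
open import Data.List.Membership.Propositional using (_∈_; _∉_; find; lose)
open import Data.List.Membership.DecPropositional using () renaming (_∈?_ to ∈?[_])
open import Data.List.Membership.Propositional.Properties
  using (∈-map⁺; ∈-map⁻; ∈-filter⁺; ∈-filter⁻; ∈-++⁻; ∈-++⁺ˡ; ∈-++⁺ʳ; ∈-concatMap⁺; ∈-concatMap⁻;
         ∈-deduplicate⁺; ∈-deduplicate⁻)
open import Data.List.Relation.Binary.Subset.Propositional using (_⊆_)
open import Data.List.Relation.Binary.Subset.Propositional.Properties as ⊆ using (⊆[]⇒≡[])
open import Data.List.Relation.Unary.All as All using (All; []; _∷_; all?)
open import Data.List.Relation.Unary.All.Properties using (¬All⇒Any¬)
open import Data.List.Relation.Unary.Any as Any using (Any; here; there; any?)
open import Data.List.Relation.Unary.Unique.Propositional using (Unique)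
open import Data.List.Relation.Unary.Unique.DecPropositional.Properties using (deduplicate-!)
open import Data.Maybe using (Maybe; just; nothing)
open import Data.Maybe.Properties as Maybe using ()
open import Data.Nat using (ℕ; zero; suc; _≤_; _<_; z≤n; s≤s)
open import Data.Nat.Induction using (<-wellFounded)
open import Data.Nat.Properties as ℕ using (≰⇒>; m≤n⇒m≤1+n)
open import Data.Product using (Σ; ∃-syntax; _×_; _,_; proj₁; proj₂; uncurry)
open import Data.Product.Properties using (≡-dec)
open import Data.Sum using (_⊎_; inj₁; inj₂; [_,_])
open import Data.Unit using (⊤; tt)
open import Function using (_∘_; _⇔_; mk⇔; Equivalence)
open import Induction.WellFounded using (Acc; acc)
open import Relation.Binary.Construct.On as On using ()
open import Relation.Binary.PropositionalEquality using (_≡_; _≢_; refl; sym; trans; cong; cong₂; subst)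
open import Relation.Nullary using (¬_; Dec; yes; no; ¬?; _×-dec_; _→-dec_; _⊎-dec_)
open import Relation.Nullary.Decidable using (map′)

least-upward-closed : {P : ℕ → Set} → (∀ k → Dec (P k)) → (∀ {m n} → m ≤ n → P m → P n) →
  ∀ {n} → P n → ∃[ d ] (P d × ∀ k → P k → d ≤ k)
least-upward-closed P? up {zero} p = 0 , p , λ _ _ → z≤n
least-upward-closed P? up {suc n} p with P? n
... | yes pn = least-upward-closed P? up pn
... | no ¬pn = suc n , p , λ k pk → ≰⇒> (λ k≤n → ¬pn (up k≤n pk))

module _ {A : Set} {P Q : A → Set} (P? : ∀ x → Dec (P x)) (Q? : ∀ x → Dec (Q x)) where

  filter-cong-∈ : ∀ xs → (∀ {x} → x ∈ xs → P x ⇔ Q x) → filter P? xs ≡ filter Q? xs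
  filter-cong-∈ [] _ = refl
  filter-cong-∈ (x ∷ xs) P⇔Q with P? x | Q? x
  ... | yes _  | yes _  = cong (x ∷_) (filter-cong-∈ xs (P⇔Q ∘ there))
  ... | yes px | no ¬qx = ⊥-elim (¬qx (Equivalence.to (P⇔Q (here refl)) px))
  ... | no ¬px | yes qx = ⊥-elim (¬px (Equivalence.from (P⇔Q (here refl)) qx))
  ... | no _   | no _   = filter-cong-∈ xs (P⇔Q ∘ there)

  length-filter-mono : ∀ xs → (∀ {x} → x ∈ xs → P x → Q x) → length (filter P? xs) ≤ length (filter Q? xs)
  length-filter-mono [] _ = z≤n
  length-filter-mono (x ∷ xs) P⇒Q with P? x | Q? x
  ... | yes _  | yes _  = s≤s (length-filter-mono xs (P⇒Q ∘ there))
  ... | yes px | no ¬qx = ⊥-elim (¬qx (P⇒Q (here refl) px))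
  ... | no _   | yes _  = m≤n⇒m≤1+n (length-filter-mono xs (P⇒Q ∘ there))
  ... | no _   | no _   = length-filter-mono xs (P⇒Q ∘ there)

  length-filter-strict : ∀ xs → (∀ {x} → x ∈ xs → P x → Q x) → ∃[ x ] (x ∈ xs × Q x × ¬ P x) →
    length (filter P? xs) < length (filter Q? xs)
  length-filter-strict (x ∷ xs) P⇒Q (y , y∈ , qy , ¬py) with P? x | Q? x | y∈
  ... | yes px | _      | here refl = ⊥-elim (¬py px)
  ... | no _   | no ¬qx | here refl = ⊥-elim (¬qx qy)
  ... | no _   | yes _  | here refl = s≤s (length-filter-mono xs (P⇒Q ∘ there))
  ... | yes _  | yes _  | there y∈′ = s≤s (length-filter-strict xs (P⇒Q ∘ there) (y , y∈′ , qy , ¬py))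
  ... | yes px | no ¬qx | there _   = ⊥-elim (¬qx (P⇒Q (here refl) px))
  ... | no _   | yes _  | there y∈′ = m≤n⇒m≤1+n (length-filter-strict xs (P⇒Q ∘ there) (y , y∈′ , qy , ¬py))
  ... | no _   | no _   | there y∈′ = length-filter-strict xs (P⇒Q ∘ there) (y , y∈′ , qy , ¬py)

≡[]-reflect : {A B : Set} {xs : List A} {ys : List B} → (∀ {x} → x ∈ xs → ∃[ y ] y ∈ ys) → ys ≡ [] → xs ≡ []
≡[]-reflect {xs = []}    _    _    = refl
≡[]-reflect {xs = _ ∷ _} some refl with some (here refl)
... | _ , ()

_≟V_ : (δ δ′ : Maybe ℕ) → Dec (δ ≡ δ′)
_≟V_ = Maybe.≡-dec ℕ._≟_

equations : List Rule → List Eq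
equations = concatMap K

module _ {T : List Rule} {e : Eq} where

  ∈-equations⁺ : ∀ {r} → r ∈ T → e ∈ K r → e ∈ equations T
  ∈-equations⁺ r∈T e∈r = ∈-concatMap⁺ K (lose r∈T e∈r)

  ∈-equations⁻ : e ∈ equations T → ∃[ r ] (r ∈ T × e ∈ K r)
  ∈-equations⁻ = find ∘ ∈-concatMap⁻ K

attributes : List Rule → List ℕ
attributes = map proj₁ ∘ equations

∈-attributes⁺ : ∀ {T a} → InA T a → a ∈ attributes T
∈-attributes⁺ (r , r∈T , _ , e∈r) = ∈-map⁺ proj₁ (∈-equations⁺ r∈T e∈r)

∈-attributes⁻ : ∀ {T a} → a ∈ attributes T → InA T a
∈-attributes⁻ a∈ with ∈-map⁻ proj₁ a∈
... | (a , v) , e∈T , refl with ∈-equations⁻ e∈T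
...   | r , r∈T , e∈r = r , r∈T , v , e∈r

extendedValues′ : List Rule → ℕ → List (Maybe ℕ)
extendedValues′ T a = nothing ∷ map (just ∘ proj₂) (filter (λ e → proj₁ e ℕ.≟ a) (equations T))

extendedValues : List Rule → ℕ → List (Maybe ℕ)
extendedValues T a = deduplicate _≟V_ (extendedValues′ T a)

extendedValues-unique : ∀ T a → Unique (extendedValues T a)
extendedValues-unique T a = deduplicate-! _≟V_ (extendedValues′ T a)

∈-extendedValues⁺ : ∀ {T a δ} → InEV T a δ → δ ∈ extendedValues T a
∈-extendedValues⁺ {T} {a} δ∈ = ∈-deduplicate⁺ _≟V_ {xs = extendedValues′ T a} (candidate δ∈)
  where
  candidate : ∀ {δ} → InEV T a δ → δ ∈ extendedValues′ T a
  candidate (inj₁ refl)                      = here refl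
  candidate (inj₂ (v , refl , r , r∈T , e∈r)) =
    there (∈-map⁺ (just ∘ proj₂) (∈-filter⁺ (λ e → proj₁ e ℕ.≟ a) (∈-equations⁺ r∈T e∈r) refl))

∈-extendedValues⁻ : ∀ {T a δ} → δ ∈ extendedValues T a → InEV T a δ
∈-extendedValues⁻ {T} {a} δ∈ with ∈-deduplicate⁻ _≟V_ (extendedValues′ T a) δ∈
... | here refl = inj₁ refl
... | there δ∈′ with ∈-map⁻ (just ∘ proj₂) δ∈′
...   | (_ , v) , e∈ , refl with ∈-filter⁻ (λ e → proj₁ e ℕ.≟ a) {xs = equations T} e∈
...     | e∈T , refl with ∈-equations⁻ e∈T
...       | r , r∈T , e∈r = inj₂ (v , refl , r , r∈T , e∈r)

_≟R_ : (r r′ : Rule) → Dec (r ≡ r′)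
r ≟R r′ = map′ (uncurry (cong₂ _⇒_)) (λ r≡r′ → cong K r≡r′ , cong rhs r≡r′)
  (List.≡-dec _≟Eq_ (K r) (K r′) ×-dec (rhs r ℕ.≟ rhs r′))

_≟EE_ : (e e′ : EEq) → Dec (e ≡ e′)
_≟EE_ = ≡-dec ℕ._≟_ _≟V_

all∈? : {A : Set} {P : A → Set} → (∀ x → Dec (P x)) → ∀ xs → Dec (∀ x → x ∈ xs → P x)
all∈? P? xs = map′ (λ ps x → All.lookup ps) (λ f → All.tabulate (f _)) (all? P? xs)

Clash : EEq → EEq → Set
Clash (a , δ) (a′ , δ′) = a ≡ a′ × δ ≢ δ′

inconsistent? : ∀ E → Dec (Inconsistent E)
inconsistent? E = map′ clash⇒inconsistent inconsistent⇒clash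
  (any? (λ e → any? (λ e′ → (proj₁ e ℕ.≟ proj₁ e′) ×-dec ¬? (proj₂ e ≟V proj₂ e′)) E) E)
  where
  clash⇒inconsistent : Any (λ e → Any (Clash e) E) E → Inconsistent E
  clash⇒inconsistent clash with find clash
  ... | (a , δ) , e∈ , clash′ with find clash′
  ...   | (.a , δ′) , e′∈ , refl , δ≢δ′ = a , δ , δ′ , e∈ , e′∈ , δ≢δ′
  inconsistent⇒clash : Inconsistent E → Any (λ e → Any (Clash e) E) E
  inconsistent⇒clash (a , δ , δ′ , e∈ , e′∈ , δ≢δ′) =
    Any.map (λ { refl → Any.map (λ { refl → refl , δ≢δ′ }) e′∈ }) e∈

realizes? : ∀ r E → Dec (RuleRealized r E)
realizes? r E = all? (λ e → ∈?[ _≟EE_ ] e E) (liftK (K r))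

inconsistent-mono : ∀ {X Y} → X ⊆ Y → Inconsistent X → Inconsistent Y
inconsistent-mono X⊆Y (a , δ , δ′ , e∈ , e′∈ , δ≢δ′) = a , δ , δ′ , X⊆Y e∈ , X⊆Y e′∈ , δ≢δ′

∈-liftK⁻ : ∀ {ks a δ} → (a , δ) ∈ liftK ks → ∃[ v ] (δ ≡ just v × (a , v) ∈ ks)
∈-liftK⁻ e∈ with ∈-map⁻ _ e∈
... | (_ , v) , e∈ks , refl = v , refl , e∈ks

liftK-⊆ : ∀ {ks ks′} → ks ⊆E ks′ → liftK ks ⊆ liftK ks′
liftK-⊆ ks⊆ks′ = ⊆.map⁺ _ (All.lookup ks⊆ks′)

Refutes : List EEq → Eq → Set
Refutes E (a , v) = ∃[ δ ] ((a , δ) ∈ E × δ ≢ just v)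

refutes⇒inconsistent : ∀ {r E e} → e ∈ K r → Refutes E e → Inconsistent (liftK (K r) ++ E)
refutes⇒inconsistent {r} {e = a , v} e∈r (δ , aδ∈E , δ≢v) =
  a , just v , δ , ∈-++⁺ˡ (∈-map⁺ _ e∈r) , ∈-++⁺ʳ (liftK (K r)) aδ∈E , δ≢v ∘ sym

inconsistent⇒refutes : ∀ {r E} → Consistent E → Inconsistent (liftK (K r) ++ E) →
  Inconsistent (liftK (K r)) ⊎ ∃[ e ] (e ∈ K r × Refutes E e)
inconsistent⇒refutes {r} cons (a , δ , δ′ , e∈ , e′∈ , δ≢δ′)
  with ∈-++⁻ (liftK (K r)) e∈ | ∈-++⁻ (liftK (K r)) e′∈
... | inj₁ e∈r | inj₁ e′∈r = inj₁ (a , δ , δ′ , e∈r , e′∈r , δ≢δ′)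
... | inj₂ e∈E | inj₂ e′∈E = ⊥-elim (cons (a , δ , δ′ , e∈E , e′∈E , δ≢δ′))
... | inj₁ e∈r | inj₂ e′∈E with ∈-liftK⁻ e∈r
...   | v , refl , av∈r = inj₂ ((a , v) , av∈r , δ′ , e′∈E , δ≢δ′ ∘ sym)
inconsistent⇒refutes {r} cons (a , δ , δ′ , e∈ , e′∈ , δ≢δ′)
    | inj₂ e∈E | inj₁ e′∈r with ∈-liftK⁻ e′∈r
...   | v , refl , av∈r = inj₂ ((a , v) , av∈r , δ , e∈E , δ≢δ′)

realizes-⊆ : ∀ {r′ r E} → K r′ ⊆E K r → RuleRealized r E → RuleRealized r′ E
realizes-⊆ r′⊆r rr = All.tabulate (λ e∈ → All.lookup rr (liftK-⊆ r′⊆r e∈))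

inconsistent-⊆ : ∀ {r′ r E} → K r′ ⊆E K r → Inconsistent (liftK (K r′) ++ E) → Inconsistent (liftK (K r) ++ E)
inconsistent-⊆ {E = E} r′⊆r = inconsistent-mono (⊆.++⁺ˡ E (liftK-⊆ r′⊆r))

Queried : List Rule → List EEq → Set
Queried T E = ∀ {a} → InA T a → ∃[ δ ] ((a , δ) ∈ E)

queried⇒inconsistent : ∀ {T E r} → Queried T E → r ∈ T → ¬ RuleRealized r E → Inconsistent (liftK (K r) ++ E)
queried⇒inconsistent {T} {E} {r} queried r∈T ¬rr with find (¬All⇒Any¬ (λ e → ∈?[ _≟EE_ ] e E) _ ¬rr)
... | _ , e∈ , e∉E with ∈-liftK⁻ e∈
...   | v , refl , av∈r with queried (r , r∈T , v , av∈r)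
...     | δ , aδ∈E = refutes⇒inconsistent {r} av∈r (δ , aδ∈E , λ { refl → e∉E aδ∈E })

realized : List Rule → List EEq → List Rule
realized T E = filter (λ r → realizes? r E) T

module _ {T : List Rule} {E : List EEq} {r : Rule} where

  ∈-realized⁺ : r ∈ T → RuleRealized r E → r ∈ realized T E
  ∈-realized⁺ = ∈-filter⁺ (λ r → realizes? r E)

  ∈-realized⁻ : r ∈ realized T E → r ∈ T × RuleRealized r E
  ∈-realized⁻ = ∈-filter⁻ (λ r → realizes? r E)

realized-realizes : ∀ T E → All (λ r → RuleRealized r E) (realized T E)
realized-realizes T E = All.tabulate (proj₂ ∘ ∈-realized⁻ {T})

realized-⊆ : ∀ {T T′ E} → (∀ {r} → r ∈ T → r ∈ T′) → ∀ {r} → r ∈ realized T E → r ∈ realized T′ E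
realized-⊆ T⊆T′ r∈ = let r∈T , rr = ∈-realized⁻ r∈ in ∈-realized⁺ (T⊆T′ r∈T) rr

realizes-transfer : ∀ {r E E′} → (∀ {a v} → (a , v) ∈ K r → (a , just v) ∈ E → (a , just v) ∈ E′) →
  RuleRealized r E → RuleRealized r E′
realizes-transfer {r} {E} {E′} move rr = All.tabulate (λ e∈ → move′ e∈ (All.lookup rr e∈))
  where
  move′ : ∀ {e} → e ∈ liftK (K r) → e ∈ E → e ∈ E′
  move′ e∈ with ∈-liftK⁻ e∈
  ... | _ , refl , av∈r = move av∈r

Agrees : List Rule → List EEq → List EEq → Set
Agrees R E₁ E₂ = ∀ {r a v} → r ∈ R → (a , v) ∈ K r →
  ((a , just v) ∈ E₁ ⇔ (a , just v) ∈ E₂) × (Refutes E₁ (a , v) → Refutes E₂ (a , v))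

module _ {R : List Rule} {E₁ E₂ : List EEq} (agree : Agrees R E₁ E₂) where

  agrees-realized : realized R E₁ ≡ realized R E₂
  agrees-realized = filter-cong-∈ (λ r → realizes? r E₁) (λ r → realizes? r E₂) R
    (λ {r} r∈R → mk⇔ (realizes-transfer {r} (Equivalence.to ∘ proj₁ ∘ agree r∈R))
                     (realizes-transfer {r} (Equivalence.from ∘ proj₁ ∘ agree r∈R)))

  agrees-inconsistent : ∀ {r} → r ∈ R → Consistent E₁ →
    Inconsistent (liftK (K r) ++ E₁) → Inconsistent (liftK (K r) ++ E₂)
  agrees-inconsistent {r} r∈R cons inc with inconsistent⇒refutes {r} cons inc
  ... | inj₁ inc-r = inconsistent-mono ∈-++⁺ˡ inc-r
  ... | inj₂ (e , e∈r , ref) = refutes⇒inconsistent {r} e∈r (proj₂ (agree r∈R e∈r) ref)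

record Problem : Set₁ where
  field
    Cond      : List Rule → List EEq → List Rule → Set
    good?     : ∀ T E → Dec (Cond T E (realized T E))
    relabel   : ∀ {T E τ} → All (_∈ T) τ → Cond T E τ → Cond T E (realized T E)
    queried   : ∀ {T E} → Queried T E → Cond T E (realized T E)
    transport : ∀ {R E₁ E₂} → (Consistent E₂ → Consistent E₁) → Agrees R E₁ E₂ →
                Cond R E₁ (realized R E₁) → Cond R E₂ (realized R E₂)

  Good : List Rule → List EEq → Set
  Good T E = Cond T E (realized T E)

realized≡[]⇒¬realizes : ∀ {T E r} → realized T E ≡ [] → r ∈ T → ¬ RuleRealized r E
realized≡[]⇒¬realizes {T} {E} none r∈T rr with subst (_ ∈_) none (∈-realized⁺ {T} {E} r∈T rr)
... | ()

⊆-realized : ∀ {T E τ} → All (_∈ T) τ → All (λ r → RuleRealized r E) τ → τ ⊆ realized T E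
⊆-realized τ⊆T τ-realized r∈τ = ∈-realized⁺ (All.lookup τ⊆T r∈τ) (All.lookup τ-realized r∈τ)

ESR-good? : ∀ T E → Dec (ESRCond T E (realized T E))
ESR-good? T E = ¬? (inconsistent? E) →-dec
  (all? (λ r → realizes? r E) (realized T E) ×-dec
   (List.≡-dec _≟R_ (realized T E) [] →-dec all∈? (λ r → inconsistent? (liftK (K r) ++ E)) T))

ESR-relabel : ∀ {T E τ} → All (_∈ T) τ → ESRCond T E τ → ESRCond T E (realized T E)
ESR-relabel {T} {E} τ⊆T good cons with good cons
... | τ-realized , h =
  realized-realizes T E , λ none → h (⊆[]⇒≡[] (subst (_ ⊆_) none (⊆-realized τ⊆T τ-realized)))

ESR-queried : ∀ {T E} → Queried T E → ESRCond T E (realized T E)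
ESR-queried {T} {E} queried _ =
  realized-realizes T E , λ none r r∈T → queried⇒inconsistent queried r∈T (realized≡[]⇒¬realizes none r∈T)

ESR-transport : ∀ {R E₁ E₂} → (Consistent E₂ → Consistent E₁) → Agrees R E₁ E₂ →
  ESRCond R E₁ (realized R E₁) → ESRCond R E₂ (realized R E₂)
ESR-transport {R} {E₂ = E₂} cons₂⇒cons₁ agree good cons₂ with good (cons₂⇒cons₁ cons₂)
... | _ , h = realized-realizes R E₂ , λ none r r∈R →
  agrees-inconsistent agree r∈R (cons₂⇒cons₁ cons₂) (h (trans (agrees-realized agree) none) r r∈R)

ESR : Problem
ESR = record
  { Cond = ESRCond ; good? = ESR-good? ; relabel = ESR-relabel
  ; queried = ESR-queried ; transport = ESR-transport
  }

EAD-good? : ∀ T E → Dec (EADCond T E (realized T E))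
EAD-good? T E = ¬? (inconsistent? E) →-dec
  (all? (λ r → realizes? r E) (realized T E) ×-dec
   all∈? (λ r → ¬? (∈?[ _≟R_ ] r (realized T E)) →-dec
                (¬? (∈?[ ℕ._≟_ ] (rhs r) (D (realized T E))) →-dec inconsistent? (liftK (K r) ++ E))) T)

EAD-relabel : ∀ {T E τ} → All (_∈ T) τ → EADCond T E τ → EADCond T E (realized T E)
EAD-relabel {T} {E} {τ} τ⊆T good cons with good cons
... | τ-realized , h = realized-realizes T E , λ r r∈T r∉ rhs∉ → h r r∈T (r∉ ∘ τ⊆) (rhs∉ ∘ ⊆.map⁺ rhs τ⊆)
  where
  τ⊆ : τ ⊆ realized T E
  τ⊆ = ⊆-realized τ⊆T τ-realized

EAD-queried : ∀ {T E} → Queried T E → EADCond T E (realized T E)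
EAD-queried {T} {E} queried _ =
  realized-realizes T E , λ r r∈T r∉ _ → queried⇒inconsistent queried r∈T (r∉ ∘ ∈-realized⁺ r∈T)

EAD-transport : ∀ {R E₁ E₂} → (Consistent E₂ → Consistent E₁) → Agrees R E₁ E₂ →
  EADCond R E₁ (realized R E₁) → EADCond R E₂ (realized R E₂)
EAD-transport {R} {E₁} {E₂} cons₂⇒cons₁ agree good cons₂ with good (cons₂⇒cons₁ cons₂)
... | _ , h = realized-realizes R E₂ , λ r r∈R r∉ rhs∉ →
  agrees-inconsistent agree r∈R (cons₂⇒cons₁ cons₂)
    (h r r∈R (r∉ ∘ subst (r ∈_) same) (rhs∉ ∘ subst (λ τ → rhs r ∈ D τ) same))
  where
  same : realized R E₁ ≡ realized R E₂
  same = agrees-realized agree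

EAD : Problem
EAD = record
  { Cond = EADCond ; good? = EAD-good? ; relabel = EAD-relabel
  ; queried = EAD-queried ; transport = EAD-transport
  }

-- Optimal depth via solvable paths

IsMinDepth⇒IsH : ∀ {Solves T d} → IsMinDepth Solves T d → IsH Solves T d
IsMinDepth⇒IsH {T = T} min with all? (λ r → List.≡-dec _≟Eq_ (K r) []) T
... | no attrs = inj₂ (attrs , min)
IsMinDepth⇒IsH ((leaf _ , _ , _ , refl) , _) | yes no-attrs = inj₁ (no-attrs , refl)
IsMinDepth⇒IsH ((node _ _ , ((r , r∈T , _ , e∈r) , _) , _) , _) | yes no-attrs
  with subst (_ ∈_) (All.lookup no-attrs r∈T) e∈r
... | ()

Solves : Problem → List Rule → Tree → Set
Solves P T t = AllPaths (Problem.Cond P T) [] t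

module Solvability (P : Problem) (T : List Rule) where
  open Problem P

  data Solvable (E : List EEq) : ℕ → Set where
    stop  : ∀ {k} → Good T E → Solvable E k
    query : ∀ {k} a → InA T a → (∀ δ → InEV T a δ → Solvable ((a , δ) ∷ E) k) → Solvable E (suc k)

  solvable-mono : ∀ {E m n} → Solvable E m → m ≤ n → Solvable E n
  solvable-mono (stop good)        _         = stop good
  solvable-mono (query a a∈T next) (s≤s m≤n) = query a a∈T (λ δ δ∈ → solvable-mono (next δ δ∈) m≤n)

  QueryWitness : List EEq → ℕ → Set
  QueryWitness E k = Any (λ a → All (λ δ → Solvable ((a , δ) ∷ E) k) (extendedValues T a)) (attributes T)

  solvable? : ∀ E k → Dec (Solvable E k)
  solvable? E zero    = map′ stop (λ { (stop good) → good }) (good? T E)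
  solvable? E (suc k) = map′ [ stop , from-witness ] to-witness
    (good? T E ⊎-dec any? (λ a → all? (λ δ → solvable? ((a , δ) ∷ E) k) (extendedValues T a)) (attributes T))
    where
    from-witness : QueryWitness E k → Solvable E (suc k)
    from-witness witness with find witness
    ... | a , a∈ , all = query a (∈-attributes⁻ a∈) (λ δ δ∈ → All.lookup all (∈-extendedValues⁺ δ∈))
    to-witness : Solvable E (suc k) → Good T E ⊎ QueryWitness E k
    to-witness (stop good)        = inj₁ good
    to-witness (query a a∈T next) =
      inj₂ (lose (∈-attributes⁺ a∈T) (All.tabulate (next _ ∘ ∈-extendedValues⁻)))

  SolvingTree : List EEq → ℕ → Set
  SolvingTree E k = Σ Tree λ t → IsETree T t × AllPaths (Cond T) E t × depth t ≤ k

  branches : ∀ {E a k} L → (∀ δ → δ ∈ L → SolvingTree ((a , δ) ∷ E) k) →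
    Σ (List (Maybe ℕ × Tree)) λ es →
      map proj₁ es ≡ L × IsETreeEs T es × AllPathsEs (Cond T) E a es × depthEs es ≤ k
  branches []      _    = [] , refl , tt , tt , z≤n
  branches (δ ∷ L) tree with tree δ (here refl) | branches L (λ δ′ → tree δ′ ∘ there)
  ... | t , t-tree , t-paths , t-depth | es , refl , es-trees , es-paths , es-depth =
    (δ , t) ∷ es , refl , (t-tree , es-trees) , (t-paths , es-paths) , ℕ.⊔-lub t-depth es-depth

  solvable⇒tree : ∀ {E k} → Solvable E k → SolvingTree E k
  solvable⇒tree {E} (stop good) = leaf (realized T E) , All.tabulate (proj₁ ∘ ∈-realized⁻) , good , z≤n
  solvable⇒tree {E} (query a a∈T next)
    with branches (extendedValues T a) (λ δ δ∈ → solvable⇒tree (next δ (∈-extendedValues⁻ δ∈)))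
  ... | es , labels , es-trees , es-paths , es-depth =
    node a es ,
    (a∈T , subst Unique (sym labels) (extendedValues-unique T a) ,
     (λ δ → (∈-extendedValues⁻ ∘ subst (δ ∈_) labels) , (subst (δ ∈_) (sym labels) ∘ ∈-extendedValues⁺)) ,
     es-trees) ,
    es-paths , s≤s es-depth

  mutual
    tree⇒solvable : ∀ {E} t → IsETree T t → AllPaths (Cond T) E t → Solvable E (depth t)
    tree⇒solvable (leaf τ)    τ⊆T paths = stop (relabel τ⊆T paths)
    tree⇒solvable (node a es) (a∈T , _ , labels , es-trees) paths =
      query a a∈T (λ δ δ∈ → branch⇒solvable es (proj₂ (labels δ) δ∈) es-trees paths)

    branch⇒solvable : ∀ {E a δ} es → δ ∈ map proj₁ es → IsETreeEs T es → AllPathsEs (Cond T) E a es →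
      Solvable ((a , δ) ∷ E) (depthEs es)
    branch⇒solvable ((_ , t) ∷ es) (here refl) (t-tree , _) (t-paths , _) =
      solvable-mono (tree⇒solvable t t-tree t-paths) (ℕ.m≤m⊔n (depth t) (depthEs es))
    branch⇒solvable ((_ , t) ∷ es) (there δ∈) (_ , es-trees) (_ , es-paths) =
      solvable-mono (branch⇒solvable es δ∈ es-trees es-paths) (ℕ.m≤n⊔m (depth t) (depthEs es))

  solvable-by-querying : ∀ {E} (L : List ℕ) → (∀ {a} → a ∈ L → InA T a) →
    (∀ {a} → InA T a → a ∈ L ⊎ ∃[ δ ] ((a , δ) ∈ E)) → Solvable E (length L)
  solvable-by-querying []      _    covered = stop (queried ([ (λ ()) , (λ asked → asked) ] ∘ covered))
  solvable-by-querying (a ∷ L) L⊆A covered =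
    query a (L⊆A (here refl)) λ δ _ → solvable-by-querying L (L⊆A ∘ there) (step δ ∘ covered)
    where
    step : ∀ {E b} δ → b ∈ a ∷ L ⊎ ∃[ δ′ ] ((b , δ′) ∈ E) → b ∈ L ⊎ ∃[ δ′ ] ((b , δ′) ∈ (a , δ) ∷ E)
    step δ (inj₁ (here refl)) = inj₂ (δ , here refl)
    step δ (inj₁ (there b∈L)) = inj₁ b∈L
    step δ (inj₂ (δ′ , b∈E))  = inj₂ (δ′ , there b∈E)

  least-solvable : ∃[ d ] (Solvable [] d × ∀ k → Solvable [] k → d ≤ k)
  least-solvable = least-upward-closed (solvable? []) (λ m≤n s → solvable-mono s m≤n)
    (solvable-by-querying (attributes T) ∈-attributes⁻ (inj₁ ∘ ∈-attributes⁺))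

  least-solvable⇒IsH : ∀ {d} → Solvable [] d → (∀ k → Solvable [] k → d ≤ k) → IsH (Solves P) T d
  least-solvable⇒IsH s least with solvable⇒tree s
  ... | t , t-tree , t-solves , t-depth = IsMinDepth⇒IsH {Solves P}
    ((t , t-tree , t-solves , ℕ.≤-antisym t-depth (least _ (tree⇒solvable t t-tree t-solves))) ,
     (λ t′ t′-tree t′-solves → least _ (tree⇒solvable t′ t′-tree t′-solves)))

-- Minimal rules

⊆E-refl : ∀ {xs} → xs ⊆E xs
⊆E-refl = All.tabulate (λ x∈ → x∈)

⊆E-trans : ∀ {xs ys zs} → xs ⊆E ys → ys ⊆E zs → xs ⊆E zs
⊆E-trans xs⊆ys ys⊆zs = All.tabulate (All.lookup ys⊆zs ∘ All.lookup xs⊆ys)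

module MinimalRules (S R : List Rule) (_∼_ : Rule → Rule → Set) (_∼?_ : ∀ r r′ → Dec (r ∼ r′))
  (∼-refl : ∀ {r} → r ∼ r) (∼-trans : ∀ {r r′ r″} → r ∼ r′ → r′ ∼ r″ → r ∼ r″)
  (minimal∈R : ∀ {r} → r ∈ S → ¬ Any (λ r′ → r′ ∼ r × K r′ ⊂E K r) S → r ∈ R) where

  -- Not the length of K r: conditions may list an equation twice.
  private
    rank : Rule → ℕ
    rank r = length (filter (λ x → K x ⊆E? K r) S)

    rank-< : ∀ {r′ r} → r ∈ S → K r′ ⊂E K r → rank r′ < rank r
    rank-< {r′} {r} r∈S (r′⊆r , r⊈r′) =
      length-filter-strict (λ x → K x ⊆E? K r′) (λ x → K x ⊆E? K r) S
        (λ _ x⊆r′ → ⊆E-trans x⊆r′ r′⊆r) (r , r∈S , ⊆E-refl , r⊈r′)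

  below-minimal : ∀ {r} → r ∈ S → ∃[ r′ ] (r′ ∈ R × r′ ∼ r × K r′ ⊆E K r)
  below-minimal {r} = descend r (On.wellFounded rank <-wellFounded r)
    where
    descend : ∀ r → Acc (λ r′ r → rank r′ < rank r) r → r ∈ S → ∃[ r′ ] (r′ ∈ R × r′ ∼ r × K r′ ⊆E K r)
    descend r (acc smaller) r∈S with any? (λ r′ → (r′ ∼? r) ×-dec (K r′ ⊂E? K r)) S
    ... | no ¬below = r , minimal∈R r∈S ¬below , ∼-refl , ⊆E-refl
    ... | yes below with find below
    ...   | r′ , r′∈S , r′∼r , r′⊂r with descend r′ (smaller {r′} (rank-< {r′} {r} r∈S r′⊂r)) r′∈S
    ...     | r″ , r″∈R , r″∼r′ , r″⊆r′ = r″ , r″∈R , ∼-trans r″∼r′ r′∼r , ⊆E-trans r″⊆r′ (proj₁ r′⊂r)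

  realized-below-minimal : ∀ {E r} → r ∈ realized S E → ∃[ r′ ] (r′ ∈ realized R E × r′ ∼ r)
  realized-below-minimal {E} {r} r∈ with ∈-realized⁻ r∈
  ... | r∈S , rr with below-minimal r∈S
  ...   | r′ , r′∈R , r′∼r , r′⊆r = r′ , ∈-realized⁺ {R} {E} r′∈R (realizes-⊆ {r′} {r} r′⊆r rr) , r′∼r

module _ (S : List Rule) where

  RSR⊆ : ∀ {r} → r ∈ RSR S → r ∈ S
  RSR⊆ = proj₁ ∘ ∈-filter⁻ (λ r → ¬? (any? (λ r′ → K r′ ⊂E? K r) S))

  RAD⊆ : ∀ {r} → r ∈ RAD S → r ∈ S
  RAD⊆ = proj₁ ∘ ∈-filter⁻ (λ r → ¬? (any? (λ r′ → (rhs r′ ℕ.≟ rhs r) ×-dec (K r′ ⊂E? K r)) S))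

  open MinimalRules S (RSR S) (λ _ _ → ⊤) (λ _ _ → yes tt) tt (λ _ _ → tt)
    (λ r∈S ¬below → ∈-filter⁺ (λ r → ¬? (any? (λ r′ → K r′ ⊂E? K r) S)) r∈S (¬below ∘ Any.map (tt ,_)))
    renaming (below-minimal to below-RSR; realized-below-minimal to realized-below-RSR)

  open MinimalRules S (RAD S) (λ r′ r → rhs r′ ≡ rhs r) (λ r′ r → rhs r′ ℕ.≟ rhs r) refl trans
    (∈-filter⁺ (λ r → ¬? (any? (λ r′ → (rhs r′ ℕ.≟ rhs r) ×-dec (K r′ ⊂E? K r)) S)))
    renaming (below-minimal to below-RAD; realized-below-minimal to realized-below-RAD)

  good-ESR-RSR : ∀ E → Problem.Good ESR S E ⇔ Problem.Good ESR (RSR S) E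
  good-ESR-RSR E = mk⇔ S⇒R R⇒S
    where
    S⇒R : Problem.Good ESR S E → Problem.Good ESR (RSR S) E
    S⇒R good cons = realized-realizes (RSR S) E , λ noneR r r∈R →
      let noneS : realized S E ≡ []
          noneS = ≡[]-reflect (λ r∈ → let r′ , r′∈ , _ = realized-below-RSR r∈ in r′ , r′∈) noneR
      in proj₂ (good cons) noneS r (RSR⊆ r∈R)

    R⇒S : Problem.Good ESR (RSR S) E → Problem.Good ESR S E
    R⇒S good cons = realized-realizes S E , λ noneS r r∈S →
      let r′ , r′∈R , _ , r′⊆r = below-RSR r∈S
          noneR : realized (RSR S) E ≡ []
          noneR = ≡[]-reflect (λ r∈ → _ , realized-⊆ RSR⊆ r∈) noneS
      in inconsistent-⊆ {r′} {r} r′⊆r (proj₂ (good cons) noneR r′ r′∈R)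

  good-EAD-RAD : ∀ E → Problem.Good EAD S E ⇔ Problem.Good EAD (RAD S) E
  good-EAD-RAD E = mk⇔ S⇒R R⇒S
    where
    D-realized-RAD : ∀ {s} → s ∈ D (realized S E) → s ∈ D (realized (RAD S) E)
    D-realized-RAD s∈ with ∈-map⁻ rhs s∈
    ... | r , r∈ , refl =
      let r′ , r′∈ , same-rhs = realized-below-RAD r∈ in subst (_∈ _) same-rhs (∈-map⁺ rhs r′∈)

    S⇒R : Problem.Good EAD S E → Problem.Good EAD (RAD S) E
    S⇒R good cons = realized-realizes (RAD S) E , λ r r∈R r∉ rhs∉ →
      proj₂ (good cons) r (RAD⊆ r∈R) (r∉ ∘ ∈-realized⁺ r∈R ∘ proj₂ ∘ ∈-realized⁻ {S}) (rhs∉ ∘ D-realized-RAD)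

    R⇒S : Problem.Good EAD (RAD S) E → Problem.Good EAD S E
    R⇒S good cons = realized-realizes S E , λ r r∈S _ rhs∉ →
      let r′ , r′∈R , same-rhs , r′⊆r = below-RAD r∈S
          rhs′∉ : rhs r′ ∉ D (realized (RAD S) E)
          rhs′∉ = rhs∉ ∘ subst (_∈ _) same-rhs ∘ ⊆.map⁺ rhs (realized-⊆ {E = E} RAD⊆)
      in inconsistent-⊆ {r′} {r} r′⊆r (proj₂ (good cons) r′ r′∈R (rhs′∉ ∘ ∈-map⁺ rhs) rhs′∉)

-- Passing between S and R

module Reduction (P : Problem) (S R : List Rule) (R⊆S : ∀ {r} → r ∈ R → r ∈ S)
  (good-S⇔R : ∀ E → Problem.Good P S E ⇔ Problem.Good P R E) where

  open Problem P
  module OnS = Solvability P S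
  module OnR = Solvability P R

  InA-⊆ : ∀ {a} → InA R a → InA S a
  InA-⊆ (r , r∈R , v , e∈r) = r , R⊆S r∈R , v , e∈r

  InEV-⊆ : ∀ {a δ} → InEV R a δ → InEV S a δ
  InEV-⊆ (inj₁ δ≡*)                       = inj₁ δ≡*
  InEV-⊆ (inj₂ (v , δ≡v , r , r∈R , e∈r)) = inj₂ (v , δ≡v , r , R⊆S r∈R , e∈r)

  inR? : (e : EEq) → Dec (proj₁ e ∈ attributes R)
  inR? e = ∈?[ ℕ._≟_ ] (proj₁ e) (attributes R)

  restrict : List EEq → List EEq
  restrict = filter inR?

  WithinEV : List EEq → Set
  WithinEV E = ∀ {a δ} → (a , δ) ∈ E → InEV S a δ

  SingleValuedOutside : List EEq → Set
  SingleValuedOutside E = ∀ {a δ δ′} → a ∉ attributes R → (a , δ) ∈ E → (a , δ′) ∈ E → δ ≡ δ′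

  within-∷ : ∀ {E a δ} → WithinEV E → InEV S a δ → WithinEV ((a , δ) ∷ E)
  within-∷ within δ∈ (here refl) = δ∈
  within-∷ within δ∈ (there e∈)  = within e∈

  single-valued-∷ : ∀ {E a δ} → SingleValuedOutside E → (a ∉ attributes R → ∀ {δ′} → (a , δ′) ∈ E → δ′ ≡ δ) →
    SingleValuedOutside ((a , δ) ∷ E)
  single-valued-∷ _  _     _   (here refl) (here refl)  = refl
  single-valued-∷ _  old≡δ a∉R (here refl) (there e′∈)  = sym (old≡δ a∉R e′∈)
  single-valued-∷ _  old≡δ a∉R (there e∈)  (here refl)  = old≡δ a∉R e∈
  single-valued-∷ sv _     a∉R (there e∈)  (there e′∈)  = sv a∉R e∈ e′∈

  outside-value : ∀ {E a} → WithinEV E → SingleValuedOutside E → a ∉ attributes R →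
    ∃[ δ ] (InEV S a δ × ∀ {δ′} → (a , δ′) ∈ E → δ′ ≡ δ)
  outside-value {E} {a} within sv a∉R with any? (λ e → proj₁ e ℕ.≟ a) E
  ... | yes some with find some
  ...   | (_ , δ) , aδ∈E , refl = δ , within aδ∈E , λ aδ′∈E → sv a∉R aδ′∈E aδ∈E
  outside-value {E} {a} within sv a∉R | no none =
    nothing , inj₁ refl , λ aδ′∈E → ⊥-elim (none (lose aδ′∈E refl))

  agrees-restrict : ∀ {E} → Agrees R E (restrict E)
  agrees-restrict {E} {r} {a} r∈R av∈r =
    mk⇔ keep (proj₁ ∘ ∈-filter⁻ inR? {xs = E}) , λ (δ , aδ∈E , δ≢v) → δ , keep aδ∈E , δ≢v
    where
    keep : ∀ {δ} → (a , δ) ∈ E → (a , δ) ∈ restrict E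
    keep aδ∈E = ∈-filter⁺ inR? aδ∈E (∈-attributes⁺ (r , r∈R , _ , av∈r))

  consistent-restrict : ∀ {E} → SingleValuedOutside E → Consistent (restrict E) → Consistent E
  consistent-restrict sv cons (a , δ , δ′ , aδ∈ , aδ′∈ , δ≢δ′) with ∈?[ ℕ._≟_ ] a (attributes R)
  ... | yes a∈R = cons (a , δ , δ′ , ∈-filter⁺ inR? aδ∈ a∈R , ∈-filter⁺ inR? aδ′∈ a∈R , δ≢δ′)
  ... | no a∉R  = δ≢δ′ (sv a∉R aδ∈ aδ′∈)

  restrict-solvable : ∀ {E k} → WithinEV E → SingleValuedOutside E →
    OnS.Solvable E k → OnR.Solvable (restrict E) k
  restrict-solvable within sv (OnS.stop good) =
    OnR.stop (transport (consistent-restrict sv) agrees-restrict (Equivalence.to (good-S⇔R _) good))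
  restrict-solvable {E} within sv (OnS.query {k} a _ next) = by-cases (∈?[ ℕ._≟_ ] a (attributes R))
    where
    by-cases : Dec (a ∈ attributes R) → OnR.Solvable (restrict E) (suc k)
    by-cases (yes a∈R) = OnR.query a (∈-attributes⁻ a∈R) λ δ δ∈ →
      subst (λ E′ → OnR.Solvable E′ k) (List.filter-accept inR? a∈R)
        (restrict-solvable (within-∷ within (InEV-⊆ δ∈)) (single-valued-∷ sv (λ a∉R → ⊥-elim (a∉R a∈R)))
          (next δ (InEV-⊆ δ∈)))
    by-cases (no a∉R) with outside-value within sv a∉R
    ... | δ , δ∈ , old≡δ = OnR.solvable-mono
      (subst (λ E′ → OnR.Solvable E′ k) (List.filter-reject inR? a∉R)
        (restrict-solvable (within-∷ within δ∈) (single-valued-∷ sv (λ _ → old≡δ)) (next δ δ∈)))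
      (ℕ.n≤1+n k)

  coarsenValue : ℕ → Maybe ℕ → Maybe ℕ
  coarsenValue a nothing  = nothing
  coarsenValue a (just v) with ∈?[ _≟Eq_ ] (a , v) (equations R)
  ... | yes _ = just v
  ... | no _  = nothing

  coarsenValue-fixed : ∀ {a v} → (a , v) ∈ equations R → coarsenValue a (just v) ≡ just v
  coarsenValue-fixed {a} {v} av∈R with ∈?[ _≟Eq_ ] (a , v) (equations R)
  ... | yes _   = refl
  ... | no av∉R = ⊥-elim (av∉R av∈R)

  coarsenValue-just : ∀ {a δ v} → coarsenValue a δ ≡ just v → δ ≡ just v
  coarsenValue-just {a} {just w} eq with ∈?[ _≟Eq_ ] (a , w) (equations R)
  coarsenValue-just {a} {just w} refl | yes _ = refl
  coarsenValue-just {a} {just w} ()   | no _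

  coarsenValue-InEV : ∀ a δ → InEV R a (coarsenValue a δ)
  coarsenValue-InEV a nothing  = inj₁ refl
  coarsenValue-InEV a (just v) with ∈?[ _≟Eq_ ] (a , v) (equations R)
  ... | yes av∈R = inj₂ (v , refl , ∈-equations⁻ av∈R)
  ... | no _     = inj₁ refl

  coarsen : List EEq → List EEq
  coarsen = map (λ (a , δ) → a , coarsenValue a δ)

  ∈-coarsen⁻ : ∀ {E a δ} → (a , δ) ∈ coarsen E → ∃[ δ′ ] ((a , δ′) ∈ E × δ ≡ coarsenValue a δ′)
  ∈-coarsen⁻ aδ∈ with ∈-map⁻ _ aδ∈
  ... | (_ , δ′) , aδ′∈E , refl = δ′ , aδ′∈E , refl

  agrees-coarsen : ∀ {E} → Agrees R (coarsen E) E
  agrees-coarsen {E} {r} {a} {v} r∈R av∈r = mk⇔ to from , refutes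
    where
    fixed : coarsenValue a (just v) ≡ just v
    fixed = coarsenValue-fixed (∈-equations⁺ r∈R av∈r)
    to : (a , just v) ∈ coarsen E → (a , just v) ∈ E
    to av∈ with ∈-coarsen⁻ av∈
    ... | δ′ , aδ′∈E , v≡ = subst (λ δ → (a , δ) ∈ E) (coarsenValue-just (sym v≡)) aδ′∈E
    from : (a , just v) ∈ E → (a , just v) ∈ coarsen E
    from av∈E = subst (λ δ → (a , δ) ∈ coarsen E) fixed (∈-map⁺ _ av∈E)
    refutes : Refutes (coarsen E) (a , v) → Refutes E (a , v)
    refutes (δ , aδ∈ , δ≢v) with ∈-coarsen⁻ aδ∈
    ... | δ′ , aδ′∈E , refl = δ′ , aδ′∈E , λ { refl → δ≢v fixed }

  consistent-coarsen : ∀ {E} → Consistent E → Consistent (coarsen E)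
  consistent-coarsen cons (a , δ₁ , δ₂ , aδ₁∈ , aδ₂∈ , δ₁≢δ₂) with ∈-coarsen⁻ aδ₁∈ | ∈-coarsen⁻ aδ₂∈
  ... | δ₁′ , aδ₁′∈E , refl | δ₂′ , aδ₂′∈E , refl =
    cons (a , δ₁′ , δ₂′ , aδ₁′∈E , aδ₂′∈E , λ { refl → δ₁≢δ₂ refl })

  coarsen-solvable : ∀ {E k} → OnR.Solvable (coarsen E) k → OnS.Solvable E k
  coarsen-solvable (OnR.stop good) =
    OnS.stop (Equivalence.from (good-S⇔R _) (transport consistent-coarsen agrees-coarsen good))
  coarsen-solvable (OnR.query a a∈R next) =
    OnS.query a (InA-⊆ a∈R) λ δ _ → coarsen-solvable (next (coarsenValue a δ) (coarsenValue-InEV a δ))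

  solvable-S⇔R : ∀ {k} → OnS.Solvable [] k ⇔ OnR.Solvable [] k
  solvable-S⇔R = mk⇔ (restrict-solvable (λ ()) (λ _ ())) coarsen-solvable

  same-optimal-depth : ∃[ d ] (IsH (Solves P) S d × IsH (Solves P) R d)
  same-optimal-depth with OnS.least-solvable
  ... | d , solvable , least =
    d , OnS.least-solvable⇒IsH solvable least ,
        OnR.least-solvable⇒IsH (Equivalence.to solvable-S⇔R solvable)
                               (λ k → least k ∘ Equivalence.from solvable-S⇔R)

lemma9 : (S : List Rule) → IsSystem S →
    (∃[ d ] (IsHESR S d × IsHESR (RSR S) d))
    × (∃[ d ] (IsHEAD S d × IsHEAD (RAD S) d))
lemma9 S _ = Reduction.same-optimal-depth ESR S (RSR S) (RSR⊆ S) (good-ESR-RSR S)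
           , Reduction.same-optimal-depth EAD S (RAD S) (RAD⊆ S) (good-EAD-RAD S)
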